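{- Let $T$ be a tree and $S$ a labeling of $T$ such that $(T,S)\in\mathscr{T}$. Then $\frac{\gamma_t(T)}{\gamma_{sp}(T)}=\frac{4}{3}$.
   Context: $\gamma_t(G)$ is the total domination number of $G$. For $R\subseteq V(G)$, $\overline{R}=V(G)\setminus R$; $R$ is a super dominating set if for every $u\in\overline{R}$ there exists $v\in R$ with $N(v)\cap\overline{R}=\{u\}$ ($N(v)$ the open neighborhood), and $\gamma_{sp}(G)$ is the minimum cardinality of a super dominating set. A labeling of a tree $T$ is a weak partition $S=(S_A,S_B,S_C)$ of $V(T)$ (some parts may be empty); the status of $v$ is the letter $x\in\{A,B,C\}$ with $v\in S_x$. The family $\mathscr{T}$ of labeled trees $(T,S)$ is the smallest family that (i) contains $(P_6,S_0)$, where $S_0$ gives the two leaves of $P_6$ status $C$, the two support vertices status $A$, and the two central vertices status $B$; and (ii) is closed under the operation $\mathscr{O}$: given $(T',S')\in\mathscr{T}$ and a vertex $v$ of $T'$ with status $B$, add a new path $u_1u_2u_3u_4u_5u_6$ and the edge $u_3v$, keep all old statuses, and give $u_1,u_6$ status $C$, $u_2,u_5$ status $A$, and $u_3,u_4$ status $B$. -}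

module Defs where

open import Data.Nat using (ℕ; zero; suc; _+_; _≤_)
open import Data.Fin using (Fin; zero; suc; splitAt; _↑ˡ_; _↑ʳ_)
open import Data.Fin.Subset using (Subset; _∈_; _∉_; ∣_∣)
open import Data.List using (List; []; _∷_; _++_; map)
import Data.List.Membership.Propositional as LM
open import Data.Product using (_×_; _,_; ∃; ∃-syntax; Σ)
open import Data.Sum using (_⊎_; [_,_])
open import Relation.Binary.PropositionalEquality using (_≡_)

-- A graph on vertex set Fin n, given by a list of (undirected) edges.
EdgeList : ℕ → Set
EdgeList n = List (Fin n × Fin n)

Adj : ∀ {n} → EdgeList n → Fin n → Fin n → Set
Adj E u v = LM._∈_ (u , v) E ⊎ LM._∈_ (v , u) E

data Status : Set where
  A B C : Status

Labeling : ℕ → Set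
Labeling n = Fin n → Status

-- Vertices 0..5 of a path P6 (used for the base tree and for the new path in 𝒪).
pathEdges : EdgeList 6
pathEdges = (f0 , f1) ∷ (f1 , f2) ∷ (f2 , f3) ∷ (f3 , f4) ∷ (f4 , f5) ∷ []
  where
  f0 f1 f2 f3 f4 f5 : Fin 6
  f0 = zero
  f1 = suc zero
  f2 = suc (suc zero)
  f3 = suc (suc (suc zero))
  f4 = suc (suc (suc (suc zero)))
  f5 = suc (suc (suc (suc (suc zero))))

pathLab : Labeling 6
pathLab zero = C
pathLab (suc zero) = A
pathLab (suc (suc zero)) = B
pathLab (suc (suc (suc zero))) = B
pathLab (suc (suc (suc (suc zero)))) = A
pathLab (suc (suc (suc (suc (suc zero))))) = C

-- u3 of the new path (index 2).
pathThird : Fin 6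
pathThird = suc (suc zero)

-- The operation 𝒪 on edge lists: old vertices are Fin n embedded via ↑ˡ,
-- new path vertices u1..u6 are n, …, n+5 (via ↑ʳ); edge u3 v is added.
opEdges : ∀ {n} → EdgeList n → Fin n → EdgeList (n + 6)
opEdges {n} E v =
  map (λ { (a , b) → (a ↑ˡ 6 , b ↑ˡ 6) }) E
  ++ map (λ { (a , b) → (n ↑ʳ a , n ↑ʳ b) }) pathEdges
  ++ ((n ↑ʳ pathThird , v ↑ˡ 6) ∷ [])

opLab : ∀ {n} → Labeling n → Labeling (n + 6)
opLab {n} S i = [ S , pathLab ] (splitAt n i)

-- The family 𝒯 of labeled trees (T,S): smallest family containing (P6,S0)
-- and closed under 𝒪.
data InFamily : (n : ℕ) → EdgeList n → Labeling n → Set where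
  base : InFamily 6 pathEdges pathLab
  op   : ∀ {n E S} → InFamily n E S → (v : Fin n) → S v ≡ B →
         InFamily (n + 6) (opEdges E v) (opLab S)

IsTotalDominating : ∀ {n} → EdgeList n → Subset n → Set
IsTotalDominating {n} E D = (u : Fin n) → ∃[ v ] (v ∈ D × Adj E v u)

IsSuperDominating : ∀ {n} → EdgeList n → Subset n → Set
IsSuperDominating {n} E R =
  (u : Fin n) → u ∉ R →
  ∃[ v ] (v ∈ R × Adj E v u × ((w : Fin n) → w ∉ R → Adj E v w → w ≡ u))

IsMinCard : ∀ {n} → (Subset n → Set) → ℕ → Set
IsMinCard {n} P k = (∃[ D ] (P D × ∣ D ∣ ≡ k)) × ((D : Subset n) → P D → k ≤ ∣ D ∣)

IsTotalDominationNumber : ∀ {n} → EdgeList n → ℕ → Set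
IsTotalDominationNumber E = IsMinCard (IsTotalDominating E)

IsSuperDominationNumber : ∀ {n} → EdgeList n → ℕ → Set
IsSuperDominationNumber E = IsMinCard (IsSuperDominating E)

-- A tree in the family is k copies of P₆ = u₁…u₆ (statuses C A B B A C), each new copy
-- attached by an edge between its u₃ and an earlier B-vertex; so n = 6k.
-- Total domination: {u₂,u₃,u₄,u₅} in every copy works, and since all neighbours of an
-- A- or C-vertex lie in its own copy, dominating just those vertices already costs 4 per
-- copy; hence γ_t = 4k.
-- Super domination: sending each u ∉ R to its private dominator is injective, so
-- n - |R| ≤ |R| and γ_sp ≥ 3k; the bound is attained by taking in each copy {u₂,u₃,u₆} if
-- the attachment vertex is in R, and {u₁,u₄,u₅} otherwise. Thus 3γ_t = 12k = 4γ_sp.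
module Submission where

open import Defs
open import Data.Nat using (ℕ; zero; suc; _+_; _*_; _≤_; z≤n; s≤s)
open import Data.Nat.Properties
  using (_≤?_; +-comm; *-suc; *-assoc; +-identityʳ; +-mono-≤; +-monoˡ-≤; *-cancelˡ-≤; m∸n+n≡m; suc-injective)
open import Data.Fin using (Fin; zero; suc; _↑ˡ_; _↑ʳ_; splitAt)
open import Data.Fin.Properties using (all?; any?; splitAt-↑ˡ; splitAt-↑ʳ) renaming (_≟_ to _≟ᶠ_)
open import Data.Fin.Subset using (Subset; _∈_; _∉_; ∣_∣; inside; outside; ∁; _-_)
open import Data.Fin.Subset.Properties
  using (_∈?_; nonempty?; Empty-unique; ∣⊥∣≡0; p─⊥≡p; p─q⊆p; x∈p∧x≢y⇒x∈p-y; x∈p⇒∣p-x∣<∣p∣;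
         ∣∁p∣≡n∸∣p∣; ∣p∣≤n; x∈∁p⇒x∉p)
open import Data.Vec using ([]; _∷_; _++_; here; there)
import Data.Vec as Vec
open import Data.List using (map)
open import Data.List.Membership.Propositional using () renaming (_∈_ to _∈ₗ_)
open import Data.List.Membership.Propositional.Properties using (∈-map⁺; ∈-map⁻; ∈-++⁺ˡ; ∈-++⁺ʳ; ∈-++⁻)
import Data.List.Membership.DecPropositional as DecMembership
import Data.List.Relation.Unary.Any as Any
open import Data.Product using (_×_; _,_; proj₁; proj₂; ∃-syntax)
import Data.Product as Product
open import Data.Product.Properties using (≡-dec)
open import Data.Sum using (_⊎_; inj₁; inj₂; [_,_])
import Data.Sum as Sum
open import Data.Empty using (⊥; ⊥-elim)
open import Function using (_∘_; const; _⇔_; mk⇔; Equivalence)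
open import Relation.Nullary using (Dec; yes; no; ¬?; contradiction)
open import Relation.Nullary.Decidable using (_×-dec_; _⊎-dec_; _→-dec_; map′; toWitness)
open import Relation.Binary.PropositionalEquality
  using (_≡_; _≢_; refl; sym; trans; cong; cong₂; subst; subst₂)

private
  variable
    n : ℕ
    x y : Fin n
    p : Subset n

∣p++q∣≡∣p∣+∣q∣ : ∀ {n m} (p : Subset n) (q : Subset m) → ∣ p ++ q ∣ ≡ ∣ p ∣ + ∣ q ∣
∣p++q∣≡∣p∣+∣q∣ []            q = refl
∣p++q∣≡∣p∣+∣q∣ (inside  ∷ p) q = cong suc (∣p++q∣≡∣p∣+∣q∣ p q)
∣p++q∣≡∣p∣+∣q∣ (outside ∷ p) q = ∣p++q∣≡∣p∣+∣q∣ p q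

∣∁p∣+∣p∣≡n : (p : Subset n) → ∣ ∁ p ∣ + ∣ p ∣ ≡ n
∣∁p∣+∣p∣≡n p = trans (cong (_+ ∣ p ∣) (∣∁p∣≡n∸∣p∣ p)) (m∸n+n≡m (∣p∣≤n p))

x∈p⇒∣p∣≡1+∣p-x∣ : x ∈ p → ∣ p ∣ ≡ suc ∣ p - x ∣
x∈p⇒∣p∣≡1+∣p-x∣ {p = inside  ∷ p} here        = cong (suc ∘ ∣_∣) (sym (p─⊥≡p p))
x∈p⇒∣p∣≡1+∣p-x∣ {p = inside  ∷ p} (there x∈p) = cong suc (x∈p⇒∣p∣≡1+∣p-x∣ x∈p)
x∈p⇒∣p∣≡1+∣p-x∣ {p = outside ∷ p} (there x∈p) = x∈p⇒∣p∣≡1+∣p-x∣ x∈p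

x∉p-x : x ∉ p - x
x∉p-x {x = suc x} {p = _ ∷ p} (there x∈p-x) = x∉p-x x∈p-x

x∈p-y⇒x≢y : x ∈ p - y → x ≢ y
x∈p-y⇒x≢y x∈p-x refl = x∉p-x x∈p-x

∣p∣≤∣q∣-by-injection : ∀ {p q : Subset n} (f : ∀ {x} → x ∈ p → Fin n) → (∀ {x} (x∈p : x ∈ p) → f x∈p ∈ q) →
  (∀ {x y} (x∈p : x ∈ p) (y∈p : y ∈ p) → f x∈p ≡ f y∈p → x ≡ y) → ∣ p ∣ ≤ ∣ q ∣
∣p∣≤∣q∣-by-injection = go _ refl
  where
  open Data.Nat.Properties.≤-Reasoning
  go : ∀ {n} k {p q : Subset n} → ∣ p ∣ ≡ k → (f : ∀ {x} → x ∈ p → Fin n) →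
       (∀ {x} (x∈p : x ∈ p) → f x∈p ∈ q) →
       (∀ {x y} (x∈p : x ∈ p) (y∈p : y ∈ p) → f x∈p ≡ f y∈p → x ≡ y) → ∣ p ∣ ≤ ∣ q ∣
  go {n} k {p} {q} _ f f∈q f-inj with nonempty? p
  ... | no p-empty = subst (_≤ ∣ q ∣) (sym (trans (cong ∣_∣ (Empty-unique p-empty)) (∣⊥∣≡0 n))) z≤n
  go zero ∣p∣≡0 f f∈q f-inj | yes (x , x∈p) =
    contradiction (trans (sym ∣p∣≡0) (x∈p⇒∣p∣≡1+∣p-x∣ x∈p)) λ ()
  go (suc k) {p} {q} ∣p∣≡1+k f f∈q f-inj | yes (x , x∈p) = begin
    ∣ p ∣              ≡⟨ ∣p∣≡1+∣p-x∣ ⟩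
    suc ∣ p - x ∣      ≤⟨ s≤s (go k (suc-injective (trans (sym ∣p∣≡1+∣p-x∣) ∣p∣≡1+k)) f′ f′∈q-fx f′-inj) ⟩
    suc ∣ q - f x∈p ∣  ≤⟨ x∈p⇒∣p-x∣<∣p∣ (f∈q x∈p) ⟩
    ∣ q ∣              ∎
    where
    ∣p∣≡1+∣p-x∣ : ∣ p ∣ ≡ suc ∣ p - x ∣
    ∣p∣≡1+∣p-x∣ = x∈p⇒∣p∣≡1+∣p-x∣ x∈p
    f′ : ∀ {y} → y ∈ p - x → Fin _
    f′ y∈p-x = f (p─q⊆p p _ y∈p-x)
    f′∈q-fx : ∀ {y} (y∈p-x : y ∈ p - x) → f′ y∈p-x ∈ q - f x∈p
    f′∈q-fx y∈p-x = x∈p∧x≢y⇒x∈p-y (f∈q _) (x∈p-y⇒x≢y y∈p-x ∘ f-inj _ x∈p)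
    f′-inj : ∀ {y z} (y∈p-x : y ∈ p - x) (z∈p-x : z ∈ p - x) → f′ y∈p-x ≡ f′ z∈p-x → y ≡ z
    f′-inj _ _ = f-inj _ _

↑ˡ∈++⁺ : ∀ {n m} {p : Subset n} {q : Subset m} {x : Fin n} → x ∈ p → x ↑ˡ m ∈ p ++ q
↑ˡ∈++⁺ here        = here
↑ˡ∈++⁺ (there x∈p) = there (↑ˡ∈++⁺ x∈p)

↑ˡ∈++⁻ : ∀ {n m} {p : Subset n} {q : Subset m} {x : Fin n} → x ↑ˡ m ∈ p ++ q → x ∈ p
↑ˡ∈++⁻ {p = _ ∷ _} {x = zero}  here        = here
↑ˡ∈++⁻ {p = _ ∷ _} {x = suc x} (there x∈p) = there (↑ˡ∈++⁻ x∈p)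

↑ʳ∈++⁺ : ∀ {n m} {p : Subset n} {q : Subset m} {y : Fin m} → y ∈ q → n ↑ʳ y ∈ p ++ q
↑ʳ∈++⁺ {p = []}    y∈q = y∈q
↑ʳ∈++⁺ {p = _ ∷ p} y∈q = there (↑ʳ∈++⁺ {p = p} y∈q)

↑ʳ∈++⁻ : ∀ {n m} {p : Subset n} {q : Subset m} {y : Fin m} → n ↑ʳ y ∈ p ++ q → y ∈ q
↑ʳ∈++⁻ {p = []}    y∈q         = y∈q
↑ʳ∈++⁻ {p = _ ∷ p} (there y∈q) = ↑ʳ∈++⁻ {p = p} y∈q

data SplitView (n m : ℕ) : Fin (n + m) → Set where
  inˡ : (x : Fin n) → SplitView n m (x ↑ˡ m)
  inʳ : (y : Fin m) → SplitView n m (n ↑ʳ y)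

splitView : ∀ n m (x : Fin (n + m)) → SplitView n m x
splitView zero    m x       = inʳ x
splitView (suc n) m zero    = inˡ zero
splitView (suc n) m (suc x) with splitView n m x
... | inˡ x = inˡ (suc x)
... | inʳ y = inʳ y

allSubsets? : {P : Subset n → Set} → (∀ q → Dec (P q)) → Dec (∀ q → P q)
allSubsets? {zero}  P? = map′ (λ { P[] [] → P[] }) (λ ∀P → ∀P []) (P? [])
allSubsets? {suc n} P? =
  map′ (λ { (Pin , Pout) (inside ∷ q) → Pin q ; (Pin , Pout) (outside ∷ q) → Pout q })
       (λ ∀P → (λ q → ∀P (inside ∷ q)) , (λ q → ∀P (outside ∷ q)))
       (allSubsets? (λ q → P? (inside ∷ q)) ×-dec allSubsets? (λ q → P? (outside ∷ q)))

IsNonBDominating : EdgeList n → Labeling n → Subset n → Set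
IsNonBDominating {n} E S D = (u : Fin n) → S u ≢ B → ∃[ w ] (w ∈ D × Adj E w u)

superDominating⇒∣∁R∣≤∣R∣ : ∀ {E : EdgeList n} {R : Subset n} → IsSuperDominating E R → ∣ ∁ R ∣ ≤ ∣ R ∣
superDominating⇒∣∁R∣≤∣R∣ {E = E} {R} R-sd =
  ∣p∣≤∣q∣-by-injection privateDominator privateDominator∈R privateDominator-injective
  where
  privateDominator : ∀ {u} → u ∈ ∁ R → Fin _
  privateDominator u∈∁R = proj₁ (R-sd _ (x∈∁p⇒x∉p u∈∁R))
  privateDominator∈R : ∀ {u} (u∈∁R : u ∈ ∁ R) → privateDominator u∈∁R ∈ R
  privateDominator∈R u∈∁R = proj₁ (proj₂ (R-sd _ (x∈∁p⇒x∉p u∈∁R)))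
  privateDominator-injective : ∀ {u u′} (u∈∁R : u ∈ ∁ R) (u′∈∁R : u′ ∈ ∁ R) →
    privateDominator u∈∁R ≡ privateDominator u′∈∁R → u ≡ u′
  privateDominator-injective {u} {u′} u∈∁R u′∈∁R same
    with R-sd u (x∈∁p⇒x∉p u∈∁R) | R-sd u′ (x∈∁p⇒x∉p u′∈∁R)
  ... | _ , _ , _ , only-u | _ , _ , w′~u′ , _ =
    sym (only-u u′ (x∈∁p⇒x∉p u′∈∁R) (subst (λ w → Adj E w u′) (sym same) w′~u′))

superDominating⇒n≤2∣R∣ : ∀ {E : EdgeList n} {R : Subset n} → IsSuperDominating E R → n ≤ 2 * ∣ R ∣
superDominating⇒n≤2∣R∣ {n} {R = R} R-sd = begin
  n                ≡⟨ sym (∣∁p∣+∣p∣≡n R) ⟩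
  ∣ ∁ R ∣ + ∣ R ∣  ≤⟨ +-monoˡ-≤ ∣ R ∣ (superDominating⇒∣∁R∣≤∣R∣ R-sd) ⟩
  ∣ R ∣ + ∣ R ∣    ≡⟨ cong (∣ R ∣ +_) (sym (+-identityʳ ∣ R ∣)) ⟩
  2 * ∣ R ∣        ∎
  where open Data.Nat.Properties.≤-Reasoning

_≟B : (s : Status) → Dec (s ≡ B)
A ≟B = no λ ()
B ≟B = yes refl
C ≟B = no λ ()

module _ (E : EdgeList n) where
  open DecMembership (≡-dec (_≟ᶠ_ {n}) (_≟ᶠ_ {n})) using () renaming (_∈?_ to _∈ₗ?_)

  adj? : ∀ u v → Dec (Adj E u v)
  adj? u v = ((u , v) ∈ₗ? E) ⊎-dec ((v , u) ∈ₗ? E)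

  totalDominating? : ∀ D → Dec (IsTotalDominating E D)
  totalDominating? D = all? λ u → any? λ w → (w ∈? D) ×-dec adj? w u

  superDominating? : ∀ R → Dec (IsSuperDominating E R)
  superDominating? R = all? λ u → ¬? (u ∈? R) →-dec any? λ w →
    (w ∈? R) ×-dec adj? w u ×-dec all? λ z → ¬? (z ∈? R) →-dec adj? w z →-dec (z ≟ᶠ u)

  nonBDominating? : ∀ S D → Dec (IsNonBDominating E S D)
  nonBDominating? S D = all? λ u → ¬? (S u ≟B) →-dec any? λ w → (w ∈? D) ×-dec adj? w u

opLab-↑ˡ : ∀ (S : Labeling n) a → opLab S (a ↑ˡ 6) ≡ S a
opLab-↑ˡ {n} S a = cong [ S , pathLab ] (splitAt-↑ˡ n a 6)

opLab-↑ʳ : ∀ (S : Labeling n) j → opLab S (n ↑ʳ j) ≡ pathLab j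
opLab-↑ʳ {n} S j = cong [ S , pathLab ] (splitAt-↑ʳ n 6 j)

pathTD₂₃₄₅ pathSD₁₄₅ pathSD₂₃₆ : Subset 6
pathTD₂₃₄₅ = outside ∷ inside  ∷ inside  ∷ inside  ∷ inside  ∷ outside ∷ []
pathSD₁₄₅  = inside  ∷ outside ∷ outside ∷ inside  ∷ inside  ∷ outside ∷ []
pathSD₂₃₆  = outside ∷ inside  ∷ inside  ∷ outside ∷ outside ∷ inside  ∷ []

pathTD₂₃₄₅-totalDominating : IsTotalDominating pathEdges pathTD₂₃₄₅
pathTD₂₃₄₅-totalDominating = toWitness {a? = totalDominating? pathEdges pathTD₂₃₄₅} _

pathSD₁₄₅-superDominating : IsSuperDominating pathEdges pathSD₁₄₅
pathSD₁₄₅-superDominating = toWitness {a? = superDominating? pathEdges pathSD₁₄₅} _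

pathSD₂₃₆-superDominating : IsSuperDominating pathEdges pathSD₂₃₆
pathSD₂₃₆-superDominating = toWitness {a? = superDominating? pathEdges pathSD₂₃₆} _

pathSuperDominatingSet : {P : Set} → Dec P →
  ∃[ q ] (IsSuperDominating pathEdges q × ∣ q ∣ ≡ 3 × (P ⇔ pathThird ∈ q))
pathSuperDominatingSet (yes p) =
  pathSD₂₃₆ , pathSD₂₃₆-superDominating , refl , mk⇔ (const (there (there here))) (const p)
pathSuperDominatingSet (no ¬p) =
  pathSD₁₄₅ , pathSD₁₄₅-superDominating , refl , mk⇔ (⊥-elim ∘ ¬p) λ { (there (there ())) }

-- The leaves force u₂ and u₅ into q, and these two need neighbours in q as well,
-- one among u₁, u₃ and one among u₄, u₆; checked over all 64 subsets.
pathNonBDominating⇒4≤ : (q : Subset 6) → IsNonBDominating pathEdges pathLab q → 4 ≤ ∣ q ∣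
pathNonBDominating⇒4≤ = toWitness {a? = allSubsets? λ q → nonBDominating? pathEdges pathLab q →-dec (4 ≤? ∣ q ∣)} _

module Extension {n : ℕ} (E : EdgeList n) (v : Fin n) where

  private
    E⁺ : EdgeList (n + 6)
    E⁺ = opEdges E v
    oldEdge : Fin n × Fin n → Fin (n + 6) × Fin (n + 6)
    oldEdge = Product.map (_↑ˡ 6) (_↑ˡ 6)
    newEdge : Fin 6 × Fin 6 → Fin (n + 6) × Fin (n + 6)
    newEdge = Product.map (n ↑ʳ_) (n ↑ʳ_)

  EdgeCase : Fin n ⊎ Fin 6 → Fin n ⊎ Fin 6 → Set
  EdgeCase (inj₁ a) (inj₁ b) = (a , b) ∈ₗ E
  EdgeCase (inj₂ j) (inj₂ k) = (j , k) ∈ₗ pathEdges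
  EdgeCase (inj₂ j) (inj₁ b) = j ≡ pathThird × b ≡ v
  EdgeCase (inj₁ _) (inj₂ _) = ⊥

  AdjCase : Fin n ⊎ Fin 6 → Fin n ⊎ Fin 6 → Set
  AdjCase s t = EdgeCase s t ⊎ EdgeCase t s

  edge⁻ : ∀ {x y} → (x , y) ∈ₗ E⁺ → EdgeCase (splitAt n x) (splitAt n y)
  edge⁻ xy∈ with ∈-++⁻ (map oldEdge E) xy∈
  ... | inj₁ old with ∈-map⁻ oldEdge old
  ...   | (a , b) , ab∈E , refl = subst₂ EdgeCase (sym (splitAt-↑ˡ n a 6)) (sym (splitAt-↑ˡ n b 6)) ab∈E
  edge⁻ xy∈ | inj₂ rest with ∈-++⁻ (map newEdge pathEdges) rest
  ... | inj₁ new with ∈-map⁻ newEdge new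
  ...   | (j , k) , jk∈P , refl = subst₂ EdgeCase (sym (splitAt-↑ʳ n 6 j)) (sym (splitAt-↑ʳ n 6 k)) jk∈P
  edge⁻ xy∈ | inj₂ rest | inj₂ (Any.here refl) =
    subst₂ EdgeCase (sym (splitAt-↑ʳ n 6 pathThird)) (sym (splitAt-↑ˡ n v 6)) (refl , refl)

  adj⁻ : ∀ {x y} → Adj E⁺ x y → AdjCase (splitAt n x) (splitAt n y)
  adj⁻ = Sum.map edge⁻ edge⁻

  adj-↑ˡ⁺ : ∀ {a b} → Adj E a b → Adj E⁺ (a ↑ˡ 6) (b ↑ˡ 6)
  adj-↑ˡ⁺ = Sum.map (∈-++⁺ˡ ∘ ∈-map⁺ oldEdge) (∈-++⁺ˡ ∘ ∈-map⁺ oldEdge)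

  adj-↑ʳ⁺ : ∀ {j k} → Adj pathEdges j k → Adj E⁺ (n ↑ʳ j) (n ↑ʳ k)
  adj-↑ʳ⁺ = Sum.map (∈-++⁺ʳ _ ∘ ∈-++⁺ˡ ∘ ∈-map⁺ newEdge) (∈-++⁺ʳ _ ∘ ∈-++⁺ˡ ∘ ∈-map⁺ newEdge)

  adj-↑ˡ⁻ : ∀ {a b} → Adj E⁺ (a ↑ˡ 6) (b ↑ˡ 6) → Adj E a b
  adj-↑ˡ⁻ {a} {b} = subst₂ AdjCase (splitAt-↑ˡ n a 6) (splitAt-↑ˡ n b 6) ∘ adj⁻

  adj-↑ʳ⁻ : ∀ {j k} → Adj E⁺ (n ↑ʳ j) (n ↑ʳ k) → Adj pathEdges j k
  adj-↑ʳ⁻ {j} {k} = subst₂ AdjCase (splitAt-↑ʳ n 6 j) (splitAt-↑ʳ n 6 k) ∘ adj⁻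

  adj-↑ˡ↑ʳ⁻ : ∀ {a k} → Adj E⁺ (a ↑ˡ 6) (n ↑ʳ k) → a ≡ v × k ≡ pathThird
  adj-↑ˡ↑ʳ⁻ {a} {k} = [ ⊥-elim , Product.swap ] ∘ subst₂ AdjCase (splitAt-↑ˡ n a 6) (splitAt-↑ʳ n 6 k) ∘ adj⁻

  totalDominating-++ : ∀ {D q} → IsTotalDominating E D → IsTotalDominating pathEdges q →
                       IsTotalDominating E⁺ (D ++ q)
  totalDominating-++ D-td q-td u with splitView n 6 u
  ... | inˡ a with D-td a
  ...   | w , w∈D , w~a = w ↑ˡ 6 , ↑ˡ∈++⁺ w∈D , adj-↑ˡ⁺ w~a
  totalDominating-++ {D} D-td q-td u | inʳ j with q-td j
  ...   | s , s∈q , s~j = n ↑ʳ s , ↑ʳ∈++⁺ {p = D} s∈q , adj-↑ʳ⁺ s~j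

  superDominating-++ : ∀ {R q} → IsSuperDominating E R → IsSuperDominating pathEdges q →
                       v ∈ R ⇔ pathThird ∈ q → IsSuperDominating E⁺ (R ++ q)
  superDominating-++ {R} {q} R-sd q-sd v∈R⇔u₃∈q u u∉R++q with splitView n 6 u
  ... | inˡ a with R-sd a (u∉R++q ∘ ↑ˡ∈++⁺)
  ...   | w , w∈R , w~a , only-a = w ↑ˡ 6 , ↑ˡ∈++⁺ w∈R , adj-↑ˡ⁺ w~a , only
    where
    only : ∀ z → z ∉ R ++ q → Adj E⁺ (w ↑ˡ 6) z → z ≡ a ↑ˡ 6
    only z z∉R++q w~z with splitView n 6 z
    ... | inˡ b = cong (_↑ˡ 6) (only-a b (z∉R++q ∘ ↑ˡ∈++⁺) (adj-↑ˡ⁻ w~z))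
    ... | inʳ k with adj-↑ˡ↑ʳ⁻ w~z
    ...   | refl , refl = contradiction (↑ʳ∈++⁺ {p = R} (Equivalence.to v∈R⇔u₃∈q w∈R)) z∉R++q
  superDominating-++ {R} {q} R-sd q-sd v∈R⇔u₃∈q u u∉R++q | inʳ j with q-sd j (u∉R++q ∘ ↑ʳ∈++⁺ {p = R})
  ...   | s , s∈q , s~j , only-j = n ↑ʳ s , ↑ʳ∈++⁺ {p = R} s∈q , adj-↑ʳ⁺ s~j , only
    where
    only : ∀ z → z ∉ R ++ q → Adj E⁺ (n ↑ʳ s) z → z ≡ n ↑ʳ j
    only z z∉R++q s~z with splitView n 6 z
    ... | inʳ k = cong (n ↑ʳ_) (only-j k (z∉R++q ∘ ↑ʳ∈++⁺ {p = R}) (adj-↑ʳ⁻ s~z))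
    ... | inˡ b with adj-↑ˡ↑ʳ⁻ (Sum.swap s~z)
    ...   | refl , refl = contradiction (↑ˡ∈++⁺ (Equivalence.from v∈R⇔u₃∈q s∈q)) z∉R++q

  module _ {S : Labeling n} {p : Subset n} {q : Subset 6}
           (dominating : IsNonBDominating E⁺ (opLab S) (p ++ q)) where

    nonBDominating-restrictˡ : S v ≡ B → IsNonBDominating E S p
    nonBDominating-restrictˡ Sv≡B a Sa≢B with dominating (a ↑ˡ 6) (Sa≢B ∘ trans (sym (opLab-↑ˡ S a)))
    ... | w , w∈p++q , w~a with splitView n 6 w
    ...   | inˡ b = b , ↑ˡ∈++⁻ w∈p++q , adj-↑ˡ⁻ w~a
    ...   | inʳ k with adj-↑ˡ↑ʳ⁻ (Sum.swap w~a)
    ...     | refl , _ = contradiction Sv≡B Sa≢B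

    nonBDominating-restrictʳ : IsNonBDominating pathEdges pathLab q
    nonBDominating-restrictʳ j Lj≢B with dominating (n ↑ʳ j) (Lj≢B ∘ trans (sym (opLab-↑ʳ S j)))
    ... | w , w∈p++q , w~j with splitView n 6 w
    ...   | inʳ k = k , ↑ʳ∈++⁻ {p = p} w∈p++q , adj-↑ʳ⁻ w~j
    ...   | inˡ b with adj-↑ˡ↑ʳ⁻ w~j
    ...     | _ , refl = contradiction refl Lj≢B

  nonBDominating⇒+4≤ : ∀ {S m} → S v ≡ B → (∀ D → IsNonBDominating E S D → m ≤ ∣ D ∣) →
                       ∀ D → IsNonBDominating E⁺ (opLab S) D → m + 4 ≤ ∣ D ∣
  nonBDominating⇒+4≤ {m = m} Sv≡B bound D dominating with Vec.splitAt n D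
  ... | p , q , refl = begin
    m + 4            ≤⟨ +-mono-≤ (bound p (nonBDominating-restrictˡ dominating Sv≡B))
                                 (pathNonBDominating⇒4≤ q (nonBDominating-restrictʳ dominating)) ⟩
    ∣ p ∣ + ∣ q ∣    ≡⟨ sym (∣p++q∣≡∣p∣+∣q∣ p q) ⟩
    ∣ p ++ q ∣       ∎
    where open Data.Nat.Properties.≤-Reasoning

c*k+c≡c*[1+k] : ∀ c k → c * k + c ≡ c * suc k
c*k+c≡c*[1+k] c k = trans (+-comm (c * k) c) (sym (*-suc c k))

-- k counts the copies of P₆. The bound is stated for the weaker non-B domination
-- because, unlike total domination, it restricts to the old tree and the new path.
record Certificate (n : ℕ) (E : EdgeList n) (S : Labeling n) : Set where
  field
    k                   : ℕ
    n≡6k                : n ≡ 6 * k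
    D                   : Subset n
    D-totalDominating   : IsTotalDominating E D
    ∣D∣≡4k              : ∣ D ∣ ≡ 4 * k
    R                   : Subset n
    R-superDominating   : IsSuperDominating E R
    ∣R∣≡3k              : ∣ R ∣ ≡ 3 * k
    nonBDominating⇒4k≤ : ∀ D′ → IsNonBDominating E S D′ → 4 * k ≤ ∣ D′ ∣

pathCertificate : Certificate 6 pathEdges pathLab
pathCertificate = record
  { k = 1 ; n≡6k = refl
  ; D = pathTD₂₃₄₅ ; D-totalDominating = pathTD₂₃₄₅-totalDominating ; ∣D∣≡4k = refl
  ; R = pathSD₁₄₅ ; R-superDominating = pathSD₁₄₅-superDominating ; ∣R∣≡3k = refl
  ; nonBDominating⇒4k≤ = pathNonBDominating⇒4≤
  }

extendCertificate : ∀ {E : EdgeList n} {S} → Certificate n E S → (v : Fin n) → S v ≡ B →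
                    Certificate (n + 6) (opEdges E v) (opLab S)
extendCertificate {E = E} c v Sv≡B with pathSuperDominatingSet (v ∈? Certificate.R c)
... | q , q-superDominating , ∣q∣≡3 , v∈R⇔u₃∈q = record
  { k = suc k
  ; n≡6k = trans (cong (_+ 6) n≡6k) (c*k+c≡c*[1+k] 6 k)
  ; D = D ++ pathTD₂₃₄₅
  ; D-totalDominating = totalDominating-++ D-totalDominating pathTD₂₃₄₅-totalDominating
  ; ∣D∣≡4k = trans (∣p++q∣≡∣p∣+∣q∣ D pathTD₂₃₄₅) (trans (cong (_+ 4) ∣D∣≡4k) (c*k+c≡c*[1+k] 4 k))
  ; R = R ++ q
  ; R-superDominating = superDominating-++ R-superDominating q-superDominating v∈R⇔u₃∈q
  ; ∣R∣≡3k = trans (∣p++q∣≡∣p∣+∣q∣ R q) (trans (cong₂ _+_ ∣R∣≡3k ∣q∣≡3) (c*k+c≡c*[1+k] 3 k))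
  ; nonBDominating⇒4k≤ = λ D′ dominating →
      subst (_≤ ∣ D′ ∣) (c*k+c≡c*[1+k] 4 k) (nonBDominating⇒+4≤ Sv≡B nonBDominating⇒4k≤ D′ dominating)
  }
  where
  open Certificate c
  open Extension E v

certificate : ∀ {E : EdgeList n} {S} → InFamily n E S → Certificate n E S
certificate base            = pathCertificate
certificate (op T v Sv≡B) = extendCertificate (certificate T) v Sv≡B

lemma2p11 : ∀ {n} {E : EdgeList n} {S : Labeling n} → InFamily n E S →
    ∃[ gt ] ∃[ gsp ] (IsTotalDominationNumber E gt × IsSuperDominationNumber E gsp
      × 3 * gt ≡ 4 * gsp)
lemma2p11 {E = E} T =
  4 * k , 3 * k ,
  ((D , D-totalDominating , ∣D∣≡4k) , λ D′ D′-td → nonBDominating⇒4k≤ D′ (λ u _ → D′-td u)) ,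
  ((R , R-superDominating , ∣R∣≡3k) , λ R′ R′-sd → *-cancelˡ-≤ 2 (6k≤2∣R′∣ R′-sd)) ,
  trans (sym (*-assoc 3 4 k)) (*-assoc 4 3 k)
  where
  open Certificate (certificate T)
  6k≤2∣R′∣ : ∀ {R′} → IsSuperDominating E R′ → 2 * (3 * k) ≤ 2 * ∣ R′ ∣
  6k≤2∣R′∣ {R′} R′-sd = subst (_≤ 2 * ∣ R′ ∣) (trans n≡6k (*-assoc 2 3 k)) (superDominating⇒n≤2∣R∣ R′-sd)
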